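{- Let $\mathcal{A}$ be the set of all Arndt compositions (of all weights $n\ge 0$), and for $\sigma\in\mathcal{A}$ let $|\sigma|$ be its weight and $\mathrm{parts}(\sigma)$ its number of parts. Then, as formal power series, $$A(x,y):=\sum_{\sigma\in\mathcal{A}}x^{|\sigma|}y^{\mathrm{parts}(\sigma)}=\frac{1 - x - x^2 + x^3 + x y - x^3 y}{1 - x - x^2 + x^3 - x^3 y^2}.$$
   Context: A composition of a nonnegative integer $n$ is a finite sequence $\sigma=(\sigma_1,\dots,\sigma_\ell)$ of positive integers with $\sigma_1+\cdots+\sigma_\ell=n$; $n=|\sigma|$ is its weight and $\ell$ its number of parts (the empty composition is the unique composition of $0$, with $0$ parts). An Arndt composition is a composition with $\sigma_{2i-1}>\sigma_{2i}$ for every positive integer $i$ with $2i\le \ell$ (if $\ell$ is odd, the last part is unconstrained). -}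

module Defs where

open import Data.Nat as ℕ using (ℕ; zero; suc; _<_)
open import Data.Nat.Properties using (_<?_)
import Data.Nat.Properties as ℕP
open import Data.Integer as ℤ using (ℤ; +_; -_)
open import Data.List using (List; []; _∷_; map; concatMap; filter; length; upTo)
open import Data.Nat.ListAction using (sum)
open import Data.List.Relation.Unary.All using (All; all?)
open import Data.Product using (_×_)
open import Data.Unit using (⊤; tt)
open import Relation.Nullary using (Dec; yes; no)
open import Relation.Nullary.Decidable using (_×-dec_)
open import Relation.Binary.PropositionalEquality using (_≡_)

IsComposition : ℕ → List ℕ → Set
IsComposition n σ = All (λ a → 0 < a) σ × sum σ ≡ n

IsArndt : List ℕ → Set
IsArndt []            = ⊤
IsArndt (a ∷ [])      = ⊤
IsArndt (a ∷ b ∷ σ)   = b < a × IsArndt σ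

isArndt? : (σ : List ℕ) → Dec (IsArndt σ)
isArndt? []          = yes tt
isArndt? (a ∷ [])    = yes tt
isArndt? (a ∷ b ∷ σ) = (b <? a) ×-dec isArndt? σ

isComposition? : (n : ℕ) (σ : List ℕ) → Dec (IsComposition n σ)
isComposition? n σ = all? (λ a → 0 <? a) σ ×-dec (sum σ ℕ.≟ n)

listsOfLength : ℕ → ℕ → List (List ℕ)
listsOfLength zero    m = [] ∷ []
listsOfLength (suc k) m = concatMap (λ a → map (a ∷_) (listsOfLength k m)) (upTo (suc m))

-- Number of Arndt compositions of n with exactly k parts.
-- (Every part of a composition of n is ≤ n, so the candidate list is exhaustive.)
arndtCount : ℕ → ℕ → ℕ
arndtCount n k =
  length (filter (λ σ → isComposition? n σ ×-dec isArndt? σ) (listsOfLength k n))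

-- Formal power series in x, y over ℤ: coefficient of x^n y^k.
Series : Set
Series = ℕ → ℕ → ℤ

sumTo : ℕ → (ℕ → ℤ) → ℤ
sumTo zero    f = f 0
sumTo (suc n) f = sumTo n f ℤ.+ f (suc n)

_⋆_ : Series → Series → Series
(f ⋆ g) n k = sumTo n (λ i → sumTo k (λ j → f i j ℤ.* g (n ℕ.∸ i) (k ℕ.∸ j)))

A : Series
A n k = + arndtCount n k

numer : Series
numer 0 0 = + 1
numer 1 0 = - (+ 1)
numer 2 0 = - (+ 1)
numer 3 0 = + 1
numer 1 1 = + 1
numer 3 1 = - (+ 1)
numer _ _ = + 0

denom : Series
denom 0 0 = + 1
denom 1 0 = - (+ 1)
denom 2 0 = - (+ 1)
denom 3 0 = + 1
denom 3 2 = - (+ 1)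
denom _ _ = + 0

-- An Arndt composition with at least two parts starts with a pair a > b ≥ 1 followed by an
-- arbitrary Arndt composition of n − a − b.  The pairs of weight s are counted by ⌊(s − 1)/2⌋,
-- whose generating function is x³/((1 − x)(1 − x²)), so the series A_k of Arndt compositions with
-- k parts satisfies (1 − x)(1 − x²) A_{k+2} = x³ A_k.  Together with A_0 = 1 and A_1 = x/(1 − x)
-- this gives the claimed identity coefficient by coefficient.

{-# OPTIONS --safe #-}
module Submission where

open import Defs
open import Data.Nat using (ℕ)
open import Relation.Binary.PropositionalEquality using (_≡_; refl; sym; trans; cong; cong₂; subst)
open Relation.Binary.PropositionalEquality.≡-Reasoning
open import Level using (Level)
open import Data.Bool using (true; false; if_then_else_)
open import Data.List using (List; []; _∷_; _++_; map; concatMap; filter; length; upTo; applyUpTo)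
open import Data.List.Properties
  using (filter-++; filter-≐; filter-none; filter-accept; filter-reject; length-++; map-upTo)
open import Data.List.Relation.Unary.All using (_∷_; []; universal)
open import Data.Nat.ListAction using (sum)
open import Data.Product using (_×_; _,_; proj₁; proj₂)
open import Data.Unit using (tt)
open import Function using (_∘_; _⇔_; mk⇔; Equivalence)
open import Relation.Nullary using (Dec; yes; no; does; ¬_)
open import Relation.Nullary.Decidable using (_×-dec_; dec-true; dec-false; does-⇔)
open import Relation.Unary using (Pred; Decidable)
open import Relation.Binary.Definitions using (tri<; tri≈; tri>)

module _ where
  open import Data.Nat using (zero; suc; _+_; _∸_; _<_; _≤_; _≟_; _<?_; _≤?_; s≤s; s≤s⁻¹; z<s; s<s)
  open import Data.Nat.Properties
  open import Data.Nat.Tactic.RingSolver using (solve-∀)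
  open import Algebra.Properties.CommutativeSemigroup +-commutativeSemigroup using (interchange)

  private variable a b p q c : Level

  ∑ : ℕ → (ℕ → ℕ) → ℕ
  ∑ m f = sum (applyUpTo f m)

  ∑-cong : ∀ m {f g : ℕ → ℕ} → (∀ i → i < m → f i ≡ g i) → ∑ m f ≡ ∑ m g
  ∑-cong zero    f≗g = refl
  ∑-cong (suc m) f≗g = cong₂ _+_ (f≗g 0 z<s) (∑-cong m (λ i i<m → f≗g (suc i) (s<s i<m)))

  ∑-zero : ∀ m {f : ℕ → ℕ} → (∀ i → i < m → f i ≡ 0) → ∑ m f ≡ 0
  ∑-zero zero    f≗0 = refl
  ∑-zero (suc m) f≗0 = cong₂ _+_ (f≗0 0 z<s) (∑-zero m (λ i i<m → f≗0 (suc i) (s<s i<m)))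

  ∑-distrib-+ : ∀ m (f g : ℕ → ℕ) → ∑ m (λ i → f i + g i) ≡ ∑ m f + ∑ m g
  ∑-distrib-+ zero    f g = refl
  ∑-distrib-+ (suc m) f g =
    trans (cong (f 0 + g 0 +_) (∑-distrib-+ m (f ∘ suc) (g ∘ suc))) (interchange (f 0) (g 0) _ _)

  ∑-sucʳ : ∀ m (f : ℕ → ℕ) → ∑ (suc m) f ≡ ∑ m f + f m
  ∑-sucʳ zero    f = +-identityʳ (f 0)
  ∑-sucʳ (suc m) f = trans (cong (f 0 +_) (∑-sucʳ m (f ∘ suc))) (sym (+-assoc (f 0) _ _))

  ∑-dropʳ : ∀ m (f : ℕ → ℕ) → f m ≡ 0 → ∑ (suc m) f ≡ ∑ m f
  ∑-dropʳ m f fm≡0 = trans (∑-sucʳ m f) (trans (cong (∑ m f +_) fm≡0) (+-identityʳ (∑ m f)))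

  ∑-indicator : ∀ {m i} v → i < m → ∑ m (λ j → if does (j ≟ i) then v else 0) ≡ v
  ∑-indicator {suc m} {zero}  v _         = trans (cong (v +_) (∑-zero m (λ _ _ → refl))) (+-identityʳ v)
  ∑-indicator {suc m} {suc i} v (s<s i<m) = ∑-indicator v i<m

  count : {A : Set a} {P : Pred A p} → Decidable P → List A → ℕ
  count P? = length ∘ filter P?

  module _ {A : Set a} {P : Pred A p} (P? : Decidable P) where

    count-++ : ∀ xs ys → count P? (xs ++ ys) ≡ count P? xs + count P? ys
    count-++ xs ys = trans (cong length (filter-++ P? xs ys)) (length-++ (filter P? xs))

    count-map : {B : Set b} (f : B → A) (xs : List B) → count P? (map f xs) ≡ count (P? ∘ f) xs
    count-map f []       = refl
    count-map f (x ∷ xs) with does (P? (f x))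
    ... | true  = cong suc (count-map f xs)
    ... | false = count-map f xs

    count-concatMap : {B : Set b} (f : B → List A) (xs : List B) →
                      count P? (concatMap f xs) ≡ sum (map (count P? ∘ f) xs)
    count-concatMap f []       = refl
    count-concatMap f (x ∷ xs) =
      trans (count-++ (f x) (concatMap f xs)) (cong (count P? (f x) +_) (count-concatMap f xs))

    count-if : {C : Set c} {Q : Pred A q} (C? : Dec C) (Q? : Decidable Q) →
               (∀ x → P x ⇔ (C × Q x)) → ∀ xs → count P? xs ≡ (if does C? then count Q? xs else 0)
    count-if {Q = Q} (yes c) Q? P⇔CQ xs = cong length (filter-≐ P? Q? (P⊆Q , Q⊆P) xs)
      where
      P⊆Q : ∀ {x} → P x → Q x
      P⊆Q {x} = proj₂ ∘ Equivalence.to (P⇔CQ x)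
      Q⊆P : ∀ {x} → Q x → P x
      Q⊆P {x} qx = Equivalence.from (P⇔CQ x) (c , qx)
    count-if (no ¬c) Q? P⇔CQ xs =
      cong length (filter-none P? (universal (λ x → ¬c ∘ proj₁ ∘ Equivalence.to (P⇔CQ x)) xs))

  count-listsOfLength-suc : {P : Pred (List ℕ) p} (P? : Decidable P) (k m : ℕ) →
    count P? (listsOfLength (suc k) m) ≡ ∑ (suc m) (λ a → count (P? ∘ (a ∷_)) (listsOfLength k m))
  count-listsOfLength-suc P? k m = begin
    count P? (concatMap extend (upTo (suc m)))
      ≡⟨ count-concatMap P? extend (upTo (suc m)) ⟩
    sum (map (count P? ∘ extend) (upTo (suc m)))
      ≡⟨ cong sum (map-upTo (count P? ∘ extend) (suc m)) ⟩
    ∑ (suc m) (count P? ∘ extend)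
      ≡⟨ ∑-cong (suc m) (λ a _ → count-map P? (a ∷_) (listsOfLength k m)) ⟩
    ∑ (suc m) (λ a → count (P? ∘ (a ∷_)) (listsOfLength k m)) ∎
    where
    extend : ℕ → List (List ℕ)
    extend a = map (a ∷_) (listsOfLength k m)

  -- evenSum G n = Σ_{b ≥ 1, 2b ≤ n} G (n − 2b), and pairSum G n = Σ_{d ≥ 1} evenSum G (n − d) is the
  -- sum of G (n − a − b) over the pairs a > b ≥ 1 with a + b ≤ n (write a = b + d).
  evenSum : (ℕ → ℕ) → ℕ → ℕ
  evenSum G (suc (suc n)) = G n + evenSum G n
  evenSum G _             = 0

  pairSum : (ℕ → ℕ) → ℕ → ℕ
  pairSum G zero    = 0
  pairSum G (suc n) = pairSum G n + evenSum G n

  pairSum-recurrence : ∀ G n →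
    pairSum G (3 + n) + pairSum G n ≡ pairSum G (2 + n) + pairSum G (1 + n) + G n
  pairSum-recurrence G n = rearrange (pairSum G (2 + n)) (G n) (evenSum G n) (pairSum G n)
    where
    rearrange : ∀ s g e t → s + (g + e) + t ≡ s + (t + e) + g
    rearrange = solve-∀

  arndt : ℕ → ℕ → ℕ
  arndt n       (suc (suc k)) = pairSum (λ j → arndt j k) n
  arndt zero    zero          = 1
  arndt (suc n) zero          = 0
  arndt zero    (suc zero)    = 0
  arndt (suc n) (suc zero)    = 1

  PairCond : ℕ → ℕ → ℕ → Set
  PairCond n a b = b < a × 0 < b × a + b ≤ n

  pairCond? : ∀ n a b → Dec (PairCond n a b)
  pairCond? n a b = (b <? a) ×-dec (0 <? b) ×-dec (a + b ≤? n)

  pairTerm : (ℕ → ℕ) → ℕ → ℕ → ℕ → ℕ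
  pairTerm G n a b = if does (pairCond? n a b) then G (n ∸ (a + b)) else 0

  DiagCond : ℕ → ℕ → Set
  DiagCond n a = 0 < a × a + a ≤ n

  diagCond? : ∀ n a → Dec (DiagCond n a)
  diagCond? n a = (0 <? a) ×-dec (a + a ≤? n)

  diagTerm : (ℕ → ℕ) → ℕ → ℕ → ℕ
  diagTerm G n a = if does (diagCond? n a) then G (n ∸ (a + a)) else 0

  pairTerm-vanishes : ∀ G n a b → ¬ PairCond n a b → pairTerm G n a b ≡ 0
  pairTerm-vanishes G n a b ¬c =
    cong (λ t → if t then G (n ∸ (a + b)) else 0) (dec-false (pairCond? n a b) ¬c)

  diagTerm-vanishes : ∀ G n a → ¬ DiagCond n a → diagTerm G n a ≡ 0
  diagTerm-vanishes G n a ¬c =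
    cong (λ t → if t then G (n ∸ (a + a)) else 0) (dec-false (diagCond? n a) ¬c)

  pairTerm-suc : ∀ G n a b →
    pairTerm G (suc n) (suc a) b ≡ pairTerm G n a b + (if does (b ≟ a) then diagTerm G n a else 0)
  pairTerm-suc G n a b with <-cmp b a
  ... | tri< b<a b≢a _
    rewrite does-⇔ (mk⇔ (λ (_ , 0<b , s) → b<a , 0<b , s≤s⁻¹ s)
                        (λ (_ , 0<b , s) → m<n⇒m<1+n b<a , 0<b , s≤s s))
                   (pairCond? (suc n) (suc a) b) (pairCond? n a b)
          | dec-false (b ≟ a) b≢a = sym (+-identityʳ _)
  ... | tri≈ _ refl _
    rewrite does-⇔ (mk⇔ (λ (_ , 0<b , s) → 0<b , s≤s⁻¹ s) (λ (0<b , s) → n<1+n b , 0<b , s≤s s))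
                   (pairCond? (suc n) (suc b) b) (diagCond? n b)
          | dec-false (pairCond? n b b) (λ (b<b , _) → <-irrefl refl b<b)
          | dec-true (b ≟ b) refl = refl
  ... | tri> _ b≢a a<b
    rewrite dec-false (pairCond? (suc n) (suc a) b) (λ (b<1+a , _) → <⇒≱ b<1+a a<b)
          | dec-false (pairCond? n a b) (λ (b<a , _) → <-asym b<a a<b)
          | dec-false (b ≟ a) b≢a = refl

  diagTerm-suc-suc : ∀ G n a → diagTerm G (2 + n) (2 + a) ≡ diagTerm G n (1 + a)
  diagTerm-suc-suc G n a rewrite +-suc a (suc a) = refl

  ∑-diagTerm : ∀ G {m} n → n < m → ∑ m (diagTerm G n) ≡ evenSum G n
  ∑-diagTerm G {m} 0 _ = ∑-zero m (λ a _ → diagTerm-vanishes G 0 a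
    (λ (0<a , 2a≤0) → <⇒≱ (+-mono-< 0<a 0<a) 2a≤0))
  ∑-diagTerm G {m} 1 _ = ∑-zero m (λ a _ → diagTerm-vanishes G 1 a
    (λ (0<a , 2a≤1) → <⇒≱ (+-mono-≤-< 0<a 0<a) 2a≤1))
  ∑-diagTerm G {suc (suc m)} (suc (suc n)) (s<s (s<s n<m)) = cong (G n +_) (begin
    ∑ m (λ a → diagTerm G (2 + n) (2 + a)) ≡⟨ ∑-cong m (λ a _ → diagTerm-suc-suc G n a) ⟩
    ∑ m (λ a → diagTerm G n (1 + a))       ≡⟨ ∑-dropʳ m (λ a → diagTerm G n (1 + a)) lastVanishes ⟨
    ∑ (2 + m) (diagTerm G n)               ≡⟨ ∑-diagTerm G n (m<n⇒m<1+n (m<n⇒m<1+n n<m)) ⟩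
    evenSum G n                            ∎)
    where
    lastVanishes : diagTerm G n (1 + m) ≡ 0
    lastVanishes = diagTerm-vanishes G n (1 + m)
      (λ (_ , 2m+2≤n) → <⇒≱ (<-≤-trans n<m (≤-trans (n≤1+n m) (m≤m+n (suc m) (suc m)))) 2m+2≤n)

  ∑∑-pairTerm : ∀ G {m} n → n ≤ m → ∑ (suc m) (λ a → ∑ (suc m) (pairTerm G n a)) ≡ pairSum G n
  ∑∑-pairTerm G {m} zero _ =
    ∑-zero (suc m) (λ a _ → ∑-zero (suc m) (λ b _ → pairTerm-vanishes G 0 a b
      (λ (_ , 0<b , a+b≤0) → <⇒≱ (<-≤-trans 0<b (m≤n+m b a)) a+b≤0)))
  ∑∑-pairTerm G {m} (suc n) n<m = begin
    ∑ (suc m) (row (suc n))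
      ≡⟨ cong (_+ ∑ m (row (suc n) ∘ suc)) firstRowVanishes ⟩
    ∑ m (λ a → ∑ (suc m) (pairTerm G (suc n) (suc a)))
      ≡⟨ ∑-cong m (λ a _ → trans (∑-cong (suc m) (λ b _ → pairTerm-suc G n a b))
                                 (∑-distrib-+ (suc m) (pairTerm G n a) (indicator a))) ⟩
    ∑ m (λ a → row n a + ∑ (suc m) (indicator a))
      ≡⟨ ∑-distrib-+ m (row n) (∑ (suc m) ∘ indicator) ⟩
    ∑ m (row n) + ∑ m (∑ (suc m) ∘ indicator)
      ≡⟨ cong₂ _+_ (sym (∑-dropʳ m (row n) lastRowVanishes))
                   (∑-cong m (λ a a<m → ∑-indicator (diagTerm G n a) (m<n⇒m<1+n a<m))) ⟩
    ∑ (suc m) (row n) + ∑ m (diagTerm G n)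
      ≡⟨ cong₂ _+_ (∑∑-pairTerm G n (<⇒≤ n<m)) (∑-diagTerm G n n<m) ⟩
    pairSum G n + evenSum G n ∎
    where
    row : ℕ → ℕ → ℕ
    row n a = ∑ (suc m) (pairTerm G n a)

    indicator : ℕ → ℕ → ℕ
    indicator a b = if does (b ≟ a) then diagTerm G n a else 0

    firstRowVanishes : row (suc n) 0 ≡ 0
    firstRowVanishes = ∑-zero (suc m) (λ b _ → pairTerm-vanishes G (suc n) 0 b (λ ()))

    lastRowVanishes : row n m ≡ 0
    lastRowVanishes = ∑-zero (suc m) (λ b _ → pairTerm-vanishes G n m b
      (λ (_ , _ , m+b≤n) → <⇒≱ (<-≤-trans n<m (m≤m+n m b)) m+b≤n))

  ArndtComposition : ℕ → List ℕ → Set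
  ArndtComposition n σ = IsComposition n σ × IsArndt σ

  arndtComposition? : ∀ n → Decidable (ArndtComposition n)
  arndtComposition? n σ = isComposition? n σ ×-dec isArndt? σ

  arndtComposition-∷∷ : ∀ n a b σ →
    ArndtComposition n (a ∷ b ∷ σ) ⇔ (PairCond n a b × ArndtComposition (n ∸ (a + b)) σ)
  arndtComposition-∷∷ n a b σ = mk⇔ to from
    where
    to : ArndtComposition n (a ∷ b ∷ σ) → PairCond n a b × ArndtComposition (n ∸ (a + b)) σ
    to ((_ ∷ 0<b ∷ positive , total) , b<a , arndtσ) =
      (b<a , 0<b , subst (a + b ≤_) split (m≤m+n (a + b) (sum σ))) ,
      (positive , trans (sym (m+n∸m≡n (a + b) (sum σ))) (cong (_∸ (a + b)) split)) , arndtσ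
      where
      split : a + b + sum σ ≡ n
      split = trans (+-assoc a b (sum σ)) total
    from : PairCond n a b × ArndtComposition (n ∸ (a + b)) σ → ArndtComposition n (a ∷ b ∷ σ)
    from ((b<a , 0<b , a+b≤n) , (positive , rest) , arndtσ) =
      (<-trans 0<b b<a ∷ 0<b ∷ positive , total) , b<a , arndtσ
      where
      total : a + (b + sum σ) ≡ n
      total = trans (sym (+-assoc a b (sum σ))) (trans (cong (a + b +_) rest) (m+[n∸m]≡n a+b≤n))

  count-arndt-one-part : ∀ n a →
    count (arndtComposition? n ∘ (a ∷_)) ([] ∷ []) ≡ (if does (a ≟ n) then arndt n 1 else 0)
  count-arndt-one-part n a with a ≟ n
  ... | no a≢n rewrite dec-false (a ≟ n) a≢n =
    cong length (filter-reject (arndtComposition? n ∘ (a ∷_))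
                               (λ ((_ , a+0≡n) , _) → a≢n (trans (sym (+-identityʳ a)) a+0≡n)))
  count-arndt-one-part zero    zero    | yes refl = refl
  count-arndt-one-part (suc n) (suc n) | yes refl rewrite dec-true (n ≟ n) refl =
    cong length (filter-accept (arndtComposition? (suc n) ∘ (suc n ∷_))
                               ((z<s ∷ [] , +-identityʳ (suc n)) , tt))

  -- The enumeration bound m is kept apart from n: after a first pair a, b the tail has the smaller
  -- weight n ∸ (a + b) but is still enumerated with bound m.
  count-arndt : ∀ k {m n} → n ≤ m → count (arndtComposition? n) (listsOfLength k m) ≡ arndt n k
  count-arndt zero {n = zero}  _ = refl
  count-arndt zero {n = suc n} _ = refl
  count-arndt (suc zero) {m} {n} n≤m = begin
    count (arndtComposition? n) (listsOfLength 1 m)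
      ≡⟨ count-listsOfLength-suc (arndtComposition? n) 0 m ⟩
    ∑ (suc m) (λ a → count (arndtComposition? n ∘ (a ∷_)) ([] ∷ []))
      ≡⟨ ∑-cong (suc m) (λ a _ → count-arndt-one-part n a) ⟩
    ∑ (suc m) (λ a → if does (a ≟ n) then arndt n 1 else 0)
      ≡⟨ ∑-indicator (arndt n 1) (s≤s n≤m) ⟩
    arndt n 1 ∎
  count-arndt (suc (suc k)) {m} {n} n≤m = begin
    count (arndtComposition? n) (listsOfLength (2 + k) m)
      ≡⟨ count-listsOfLength-suc (arndtComposition? n) (suc k) m ⟩
    ∑ (suc m) (λ a → count (arndtComposition? n ∘ (a ∷_)) (listsOfLength (suc k) m))
      ≡⟨ ∑-cong (suc m) (λ a _ → count-listsOfLength-suc (arndtComposition? n ∘ (a ∷_)) k m) ⟩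
    ∑ (suc m) (λ a → ∑ (suc m) (λ b → count (arndtComposition? n ∘ (a ∷_) ∘ (b ∷_)) (listsOfLength k m)))
      ≡⟨ ∑-cong (suc m) (λ a _ → ∑-cong (suc m) (λ b _ → count-pair a b)) ⟩
    ∑ (suc m) (λ a → ∑ (suc m) (pairTerm (λ j → arndt j k) n a))
      ≡⟨ ∑∑-pairTerm (λ j → arndt j k) n n≤m ⟩
    arndt n (2 + k) ∎
    where
    count-pair : ∀ a b → count (arndtComposition? n ∘ (a ∷_) ∘ (b ∷_)) (listsOfLength k m)
                         ≡ pairTerm (λ j → arndt j k) n a b
    count-pair a b = trans
      (count-if (arndtComposition? n ∘ (a ∷_) ∘ (b ∷_)) (pairCond? n a b)
                (arndtComposition? (n ∸ (a + b))) (arndtComposition-∷∷ n a b) (listsOfLength k m))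
      (cong (λ t → if does (pairCond? n a b) then t else 0)
            (count-arndt k (≤-trans (m∸n≤m n (a + b)) n≤m)))

  arndtCount≡arndt : ∀ n k → arndtCount n k ≡ arndt n k
  arndtCount≡arndt n k = count-arndt k ≤-refl

module _ where
  open import Data.Nat as ℕ using (zero; suc; _∸_; _≤_; z≤n)
  open import Data.Nat.Properties using (+-∸-assoc; n∸n≡0; ≤-refl; m≤n⇒m≤1+n)
  open import Data.Integer using (ℤ; +_; -_; _+_; _*_; _-_)
  open import Data.Integer.Properties
    using (*-identityʳ; *-zeroʳ; *-distribˡ-+; +-identityˡ; +-identityʳ; +-inverseʳ; +-commutativeSemigroup)
  open import Data.Integer.Tactic.RingSolver using (solve-∀)
  open import Algebra.Properties.CommutativeSemigroup +-commutativeSemigroup using (interchange)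

  δ : ℕ → ℕ → ℤ
  δ zero    zero    = + 1
  δ zero    (suc n) = + 0
  δ (suc d) zero    = + 0
  δ (suc d) (suc n) = δ d n

  -- delay d g is the coefficient sequence of xᵈ g, and shift d e f is the series xᵈ yᵉ f.
  delay : ℕ → (ℕ → ℤ) → ℕ → ℤ
  delay zero    g n       = g n
  delay (suc d) g zero    = + 0
  delay (suc d) g (suc n) = delay d g n

  shift : ℕ → ℕ → Series → Series
  shift d e f n k = delay d (λ i → delay e (f i) k) n

  delay-* : ∀ d c g n → delay d (λ i → c * g i) n ≡ c * delay d g n
  delay-* zero    c g n       = refl
  delay-* (suc d) c g zero    = sym (*-zeroʳ c)
  delay-* (suc d) c g (suc n) = delay-* d c g n

  sumTo-cong : ∀ n {f g : ℕ → ℤ} → (∀ i → i ≤ n → f i ≡ g i) → sumTo n f ≡ sumTo n g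
  sumTo-cong zero    f≗g = f≗g 0 z≤n
  sumTo-cong (suc n) f≗g =
    cong₂ _+_ (sumTo-cong n (λ i i≤n → f≗g i (m≤n⇒m≤1+n i≤n))) (f≗g (suc n) ≤-refl)

  sumTo-zero : ∀ n {f : ℕ → ℤ} → (∀ i → i ≤ n → f i ≡ + 0) → sumTo n f ≡ + 0
  sumTo-zero n f≗0 = trans (sumTo-cong n f≗0) (sumTo-const-0 n)
    where
    sumTo-const-0 : ∀ n → sumTo n (λ _ → + 0) ≡ + 0
    sumTo-const-0 zero    = refl
    sumTo-const-0 (suc n) = cong (_+ + 0) (sumTo-const-0 n)

  sumTo-+ : ∀ n (f g : ℕ → ℤ) → sumTo n (λ i → f i + g i) ≡ sumTo n f + sumTo n g
  sumTo-+ zero    f g = refl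
  sumTo-+ (suc n) f g =
    trans (cong (_+ (f (suc n) + g (suc n))) (sumTo-+ n f g)) (interchange (sumTo n f) (sumTo n g) _ _)

  sumTo-δ : ∀ d g n → sumTo n (λ i → g i * δ d (n ∸ i)) ≡ delay d g n
  sumTo-δ zero    g zero    = *-identityʳ (g 0)
  sumTo-δ (suc d) g zero    = *-zeroʳ (g 0)
  sumTo-δ d       g (suc n) =
    trans (cong₂ _+_ (sumTo-cong n (λ i i≤n → cong (λ e → g i * δ d e) (+-∸-assoc 1 i≤n)))
                     (cong (λ e → g (suc n) * δ d e) (n∸n≡0 n)))
          (lastTerm d)
    where
    lastTerm : ∀ d → sumTo n (λ i → g i * δ d (suc (n ∸ i))) + g (suc n) * δ d 0 ≡ delay d g (suc n)
    lastTerm zero    =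
      trans (cong₂ _+_ (sumTo-zero n (λ i _ → *-zeroʳ (g i))) (*-identityʳ (g (suc n)))) (+-identityˡ _)
    lastTerm (suc d) = trans (cong₂ _+_ (sumTo-δ d g n) (*-zeroʳ (g (suc n)))) (+-identityʳ _)

  ⋆-congˡ : ∀ {f g} h → (∀ n k → f n k ≡ g n k) → ∀ n k → (f ⋆ h) n k ≡ (g ⋆ h) n k
  ⋆-congˡ h f≗g n k =
    sumTo-cong n (λ i _ → sumTo-cong k (λ j _ → cong (_* h (n ∸ i) (k ∸ j)) (f≗g i j)))

  ⋆-congʳ : ∀ f {g h} → (∀ n k → g n k ≡ h n k) → ∀ n k → (f ⋆ g) n k ≡ (f ⋆ h) n k
  ⋆-congʳ f g≗h n k =
    sumTo-cong n (λ i _ → sumTo-cong k (λ j _ → cong (f i j *_) (g≗h (n ∸ i) (k ∸ j))))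

  ⋆-distribˡ-+ : ∀ f g h n k → (f ⋆ (λ n k → g n k + h n k)) n k ≡ (f ⋆ g) n k + (f ⋆ h) n k
  ⋆-distribˡ-+ f g h n k = trans
    (sumTo-cong n (λ i _ → trans (sumTo-cong k (λ j _ → *-distribˡ-+ (f i j) _ _)) (sumTo-+ k _ _)))
    (sumTo-+ n _ _)

  monomial : ℤ → ℕ → ℕ → Series
  monomial c d e n k = c * (δ d n * δ e k)

  ⋆-monomial : ∀ f c d e n k → (f ⋆ monomial c d e) n k ≡ c * shift d e f n k
  ⋆-monomial f c d e n k = begin
    sumTo n (λ i → sumTo k (λ j → f i j * (c * (δ d (n ∸ i) * δ e (k ∸ j)))))
      ≡⟨ sumTo-cong n (λ i _ → sumTo-cong k (λ j _ → regroup (f i j) c (δ d (n ∸ i)) (δ e (k ∸ j)))) ⟩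
    sumTo n (λ i → sumTo k (λ j → c * δ d (n ∸ i) * f i j * δ e (k ∸ j)))
      ≡⟨ sumTo-cong n (λ i _ → sumTo-δ e (λ j → c * δ d (n ∸ i) * f i j) k) ⟩
    sumTo n (λ i → delay e (λ j → c * δ d (n ∸ i) * f i j) k)
      ≡⟨ sumTo-cong n (λ i _ → trans (delay-* e (c * δ d (n ∸ i)) (f i) k) (swap c (δ d (n ∸ i)) _)) ⟩
    sumTo n (λ i → c * delay e (f i) k * δ d (n ∸ i))
      ≡⟨ sumTo-δ d (λ i → c * delay e (f i) k) n ⟩
    delay d (λ i → c * delay e (f i) k) n
      ≡⟨ delay-* d c (λ i → delay e (f i) k) n ⟩
    c * shift d e f n k ∎
    where
    regroup : ∀ x c u v → x * (c * (u * v)) ≡ c * u * x * v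
    regroup = solve-∀
    swap : ∀ c u y → c * u * y ≡ c * y * u
    swap = solve-∀

  -- A polynomial is a list of monomials c xᵈ yᵉ, each written (c , d , e).
  Polynomial : Set
  Polynomial = List (ℤ × ℕ × ℕ)

  ⟦_⟧ : Polynomial → Series
  ⟦ []              ⟧ n k = + 0
  ⟦ (c , d , e) ∷ p ⟧ n k = monomial c d e n k + ⟦ p ⟧ n k

  _·_ : Polynomial → Series → Series
  ([]                · f) n k = + 0
  (((c , d , e) ∷ p) · f) n k = c * shift d e f n k + (p · f) n k

  ⋆-⟦⟧ : ∀ f p n k → (f ⋆ ⟦ p ⟧) n k ≡ (p · f) n k
  ⋆-⟦⟧ f []                n k = sumTo-zero n (λ i _ → sumTo-zero k (λ j _ → *-zeroʳ (f i j)))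
  ⋆-⟦⟧ f ((c , d , e) ∷ p) n k =
    trans (⋆-distribˡ-+ f (monomial c d e) ⟦ p ⟧ n k)
          (cong₂ _+_ (⋆-monomial f c d e n k) (⋆-⟦⟧ f p n k))

  denominator : Polynomial
  denominator = (+ 1 , 0 , 0) ∷ (- + 1 , 1 , 0) ∷ (- + 1 , 2 , 0) ∷ (+ 1 , 3 , 0) ∷ (- + 1 , 3 , 2) ∷ []

  denom≡⟦denominator⟧ : ∀ n k → denom n k ≡ ⟦ denominator ⟧ n k
  denom≡⟦denominator⟧ 0                         0                   = refl
  denom≡⟦denominator⟧ 0                         (suc k)             = refl
  denom≡⟦denominator⟧ 1                         0                   = refl
  denom≡⟦denominator⟧ 1                         (suc k)             = refl
  denom≡⟦denominator⟧ 2                         0                   = refl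
  denom≡⟦denominator⟧ 2                         (suc k)             = refl
  denom≡⟦denominator⟧ 3                         0                   = refl
  denom≡⟦denominator⟧ 3                         1                   = refl
  denom≡⟦denominator⟧ 3                         2                   = refl
  denom≡⟦denominator⟧ 3                         (suc (suc (suc k))) = refl
  denom≡⟦denominator⟧ (suc (suc (suc (suc n)))) k                   = refl

  denominator·-vanishes : ∀ f n k →
    f (3 ℕ.+ n) (2 ℕ.+ k) + f n (2 ℕ.+ k) ≡ f (2 ℕ.+ n) (2 ℕ.+ k) + f (1 ℕ.+ n) (2 ℕ.+ k) + f n k →
    (denominator · f) (3 ℕ.+ n) (2 ℕ.+ k) ≡ + 0
  denominator·-vanishes f n k recurrence =
    trans (rearrange x₃ x₂ x₁ x₀ y)
          (trans (cong (_- (x₂ + x₁ + y)) recurrence) (+-inverseʳ (x₂ + x₁ + y)))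
    where
    x₀ x₁ x₂ x₃ y : ℤ
    x₀ = f n (2 ℕ.+ k)
    x₁ = f (1 ℕ.+ n) (2 ℕ.+ k)
    x₂ = f (2 ℕ.+ n) (2 ℕ.+ k)
    x₃ = f (3 ℕ.+ n) (2 ℕ.+ k)
    y  = f n k
    rearrange : ∀ a b c d e →
      + 1 * a + (- + 1 * b + (- + 1 * c + (+ 1 * d + (- + 1 * e + + 0)))) ≡ a + d - (b + c + e)
    rearrange = solve-∀

  Arndt : Series
  Arndt n k = + arndt n k

  A≡Arndt : ∀ n k → A n k ≡ Arndt n k
  A≡Arndt n k = cong +_ (arndtCount≡arndt n k)

  denominator·Arndt : ∀ n k → (denominator · Arndt) n k ≡ numer n k
  denominator·Arndt 0                         0             = refl
  denominator·Arndt 1                         0             = refl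
  denominator·Arndt 2                         0             = refl
  denominator·Arndt 3                         0             = refl
  denominator·Arndt (suc (suc (suc (suc n)))) 0             = refl
  denominator·Arndt 0                         1             = refl
  denominator·Arndt 1                         1             = refl
  denominator·Arndt 2                         1             = refl
  denominator·Arndt 3                         1             = refl
  denominator·Arndt (suc (suc (suc (suc n)))) 1             = refl
  denominator·Arndt 0                         (suc (suc k)) = refl
  denominator·Arndt 1                         (suc (suc k)) = refl
  denominator·Arndt 2                         (suc (suc k)) = refl
  denominator·Arndt 3                         (suc (suc k)) =
    denominator·-vanishes Arndt 0 k (cong +_ (pairSum-recurrence (λ j → arndt j k) 0))
  denominator·Arndt (suc (suc (suc (suc n)))) (suc (suc k)) =
    denominator·-vanishes Arndt (suc n) k (cong +_ (pairSum-recurrence (λ j → arndt j k) (suc n)))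

theorem2p1 : ∀ (n k : ℕ) → (A ⋆ denom) n k ≡ numer n k
theorem2p1 n k = begin
  (A ⋆ denom) n k               ≡⟨ ⋆-congˡ denom A≡Arndt n k ⟩
  (Arndt ⋆ denom) n k           ≡⟨ ⋆-congʳ Arndt denom≡⟦denominator⟧ n k ⟩
  (Arndt ⋆ ⟦ denominator ⟧) n k ≡⟨ ⋆-⟦⟧ Arndt denominator n k ⟩
  (denominator · Arndt) n k     ≡⟨ denominator·Arndt n k ⟩
  numer n k                     ∎
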